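{- Let $n\ge 1$ and $x\in\mathbb{R}$. Let $G_n$ be the graph with vertex set $\{(i,j):1\le i,j\le n+1,\ i\ne j\}$ in which $(i,j)$ and $(i',j')$ are adjacent if $|i-i'|+|j-j'|=1$, and additionally $(j,j+1)$ and $(j+1,j)$ are adjacent for each $1\le j\le n$. Define $p^{(0)}_{ij}(x)=1$ for $i<j$ and $0$ for $i>j$, and for $t\ge0$ $$p^{(t+1)}_v(x)=p^{(t)}_v(x)+x\sum_{w\sim v \text{ in } G_n}\left(p^{(t)}_w(x)-p^{(t)}_v(x)\right).$$ Let $E_{nt}(x)=\sum_{1\le j<i\le n+1}p^{(t)}_{ij}(x)$ and let $e_t(x)=\sum_{j=1}^n p^{(t)}_{j+1,j}(x)$ be the sum of the subdiagonal entries at time $t$. Then for all $t\ge1$, $$E_{nt}(x)=ntx-2x\left[e_{t-1}(x)+e_{t-2}(x)+\cdots+e_1(x)\right].$$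
   Formalization: The parameter x ranges over the rationals instead of the reals. -}

module Defs where

open import Data.Bool using (Bool; true; false; if_then_else_; _∨_; _∧_; not)
open import Data.Nat as ℕ using (ℕ; zero; suc; ∣_-_∣; _≡ᵇ_; _<ᵇ_)
open import Data.Fin using (Fin; toℕ; inject₁) renaming (suc to fsuc; zero to fzero)
open import Data.Integer using (+_)
open import Data.Rational using (ℚ; 0ℚ; 1ℚ; _+_; _*_; _-_; _/_)

ΣFin : ∀ {m} → (Fin m → ℚ) → ℚ
ΣFin {zero} f = 0ℚ
ΣFin {suc m} f = f fzero + ΣFin (λ k → f (fsuc k))

ℕ→ℚ : ℕ → ℚ
ℕ→ℚ k = (+ k) / 1

-- Vertices of G_n: pairs (i , j) of Fin (suc n) (0-based: i,j ∈ {0..n},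
-- i.e. the paper's 1..n+1 shifted down by one) with i ≠ j.
offDiag : ∀ {n} → Fin (suc n) → Fin (suc n) → Bool
offDiag i j = not (toℕ i ≡ᵇ toℕ j)

edge : ∀ {n} → (i j i' j' : Fin (suc n)) → Bool
edge i j i' j' =
  offDiag i j ∧ offDiag i' j' ∧
  ( ((∣ toℕ i - toℕ i' ∣ ℕ.+ ∣ toℕ j - toℕ j' ∣) ≡ᵇ 1)
  ∨ ((toℕ i' ≡ᵇ toℕ j) ∧ (toℕ j' ≡ᵇ toℕ i) ∧ (∣ toℕ i - toℕ j ∣ ≡ᵇ 1)) )

nbrSum : ∀ {n} → (Fin (suc n) → Fin (suc n) → ℚ) → Fin (suc n) → Fin (suc n) → ℚ
nbrSum f i j =
  ΣFin (λ i' → ΣFin (λ j' → if edge i j i' j' then f i' j' - f i j else 0ℚ))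

-- p^{(t)}_{ij}(x)  (0-based indices; value on the diagonal is irrelevant)
p : (n : ℕ) → ℚ → ℕ → Fin (suc n) → Fin (suc n) → ℚ
p n x zero i j = if toℕ i <ᵇ toℕ j then 1ℚ else 0ℚ
p n x (suc t) i j = p n x t i j + x * nbrSum (p n x t) i j

E : (n : ℕ) → ℚ → ℕ → ℚ
E n x t = ΣFin (λ i → ΣFin (λ j → if toℕ j <ᵇ toℕ i then p n x t i j else 0ℚ))

-- e_t(x) = Σ_{j=1}^{n} p^{(t)}_{j+1,j}(x)   (0-based: entries (k+1, k), k = 0..n-1)
e : (n : ℕ) → ℚ → ℕ → ℚ
e n x t = ΣFin (λ (k : Fin n) → p n x t (fsuc k) (inject₁ k))

eTail : (n : ℕ) → ℚ → ℕ → ℚ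
eTail n x zero = 0ℚ
eTail n x (suc s) = eTail n x s + e n x (suc s)

-- Transposition (i, j) ↦ (j, i) is an automorphism of G_n, so it turns the update of p_ij into
-- minus the update of p_ji; hence p⁽ᵗ⁾ stays complementary, p_ij + p_ji = 1 off the diagonal.
-- Summing the update over the lower triangle gives E_{t+1} = E_t + x·D_t, where D_t is the
-- flux Σ (p_w − p_v) over lower vertices v and their neighbours w. Terms with w also lower
-- cancel in pairs, and the only edges leaving the lower triangle are the flips
-- (j+1, j) ~ (j, j+1), contributing p_{j,j+1} − p_{j+1,j} = 1 − 2 p_{j+1,j}. So D_t = n − 2 e_t,
-- and the formula follows by induction on t from E_0 = e_0 = 0.
module Submission where

open import Defs
open import Data.Nat using (ℕ; suc; _≥_; _∸_) renaming (_*_ to _*ℕ_)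
open import Data.Rational using (ℚ; _*_; _-_)
open import Relation.Binary.PropositionalEquality using (_≡_)

open import Algebra.Bundles using (CommutativeMonoid; CommutativeRing)
open import Data.Bool using (Bool; true; false; T; not; _∧_; _∨_; if_then_else_)
open import Data.Bool.Properties using (T-∧; T-∨; T-≡; ∧-commutativeMonoid)
open import Data.Empty using (⊥-elim)
open import Data.Fin using (Fin; toℕ; inject₁; punchIn) renaming (suc to fsuc; zero to fzero)
open import Data.Fin.Properties using (toℕ-injective; toℕ-inject₁; punchInᵢ≢i)
import Data.Integer as ℤ
import Data.Integer.Properties as ℤₚ
open import Data.Nat as ℕ using (zero; _<_; ∣_-_∣; _≡ᵇ_; _<ᵇ_)
open import Data.Nat.Coprimality using (1-coprimeTo) renaming (sym to coprime-sym)
import Data.Nat.Properties as ℕₚ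
open import Data.Nat.Properties
  using ( ≡ᵇ⇒≡; ≡⇒≡ᵇ; <ᵇ⇒<; <⇒<ᵇ; +-comm; suc-injective
        ; ∣-∣-comm; ∣m-n∣≡0⇒m≡n; m≤n⇒∣m-n∣≡n∸m; m∸n+n≡m
        ; <⇒≤; <-trans; <-≤-trans; <-irrefl; m<1+n⇒m≤n; ≮⇒≥; ≤∧≢⇒< )
open import Data.Product using (_×_; _,_; proj₁; proj₂)
open import Data.Rational using (0ℚ; 1ℚ; ½; _+_; -_; _/_; mkℚ)
open import Data.Rational.Properties
  using ( _≟_; +-*-commutativeRing; ↥p/↧p≡p; +-identityˡ; +-identityʳ; +-inverseʳ
        ; *-identityʳ; *-zeroˡ; *-zeroʳ; *-distribˡ-+; *-distribʳ-+; neg-distribˡ-* )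
open import Data.Sum using (inj₁; inj₂)
open import Function using (_∘_)
open import Function.Bundles using (Equivalence)
open import Level using (0ℓ)
open import Relation.Binary.PropositionalEquality
  using (_≢_; refl; sym; trans; cong; cong₂; subst; subst₂; module ≡-Reasoning)
open import Relation.Nullary using (¬_)
open import Relation.Nullary.Decidable.Core using (dec⇒maybe)
open import Tactic.RingSolver using (solve-∀)
open import Tactic.RingSolver.Core.AlmostCommutativeRing using (AlmostCommutativeRing; fromCommutativeRing)
open import Algebra.Properties.Semiring.Sum (CommutativeRing.semiring +-*-commutativeRing)
  using (sum; sum-cong-≗; ∑-distrib-+; ∑-comm; *-distribˡ-sum; sum-replicate-zero; sum-remove)
open import Algebra.Properties.CommutativeSemigroup (CommutativeMonoid.commutativeSemigroup ∧-commutativeMonoid)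
  using () renaming (x∙yz≈y∙xz to ∧-exchange)

open Equivalence using (to; from)

ℚ-ring : AlmostCommutativeRing 0ℓ 0ℓ
ℚ-ring = fromCommutativeRing +-*-commutativeRing (λ q → dec⇒maybe (0ℚ ≟ q))

p+p≡0⇒p≡0 : ∀ {q} → q + q ≡ 0ℚ → q ≡ 0ℚ
p+p≡0⇒p≡0 {q} q+q≡0 = begin
  q              ≡⟨ *-identityʳ q ⟨
  q * (½ + ½)    ≡⟨ *-distribˡ-+ q ½ ½ ⟩
  q * ½ + q * ½  ≡⟨ *-distribʳ-+ ½ q q ⟨
  (q + q) * ½    ≡⟨ cong (_* ½) q+q≡0 ⟩
  0ℚ * ½         ≡⟨ *-zeroˡ ½ ⟩
  0ℚ             ∎
  where open ≡-Reasoning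

ℕ→ℚ≡mkℚ : ∀ k → ℕ→ℚ k ≡ mkℚ (ℤ.+ k) 0 (coprime-sym (1-coprimeTo k))
ℕ→ℚ≡mkℚ k = ↥p/↧p≡p (mkℚ (ℤ.+ k) 0 (coprime-sym (1-coprimeTo k)))

-- Rational addition computes on the normal forms mkℚ (+ k) 0 _, leaving only `+ ◃ (k * 1)`.
ℕ→ℚ-+ : ∀ a b → ℕ→ℚ (a ℕ.+ b) ≡ ℕ→ℚ a + ℕ→ℚ b
ℕ→ℚ-+ a b rewrite ℕ→ℚ≡mkℚ a | ℕ→ℚ≡mkℚ b =
  sym (cong₂ (λ u v → (u ℤ.+ v) / 1) (◃k*1≡+k a) (◃k*1≡+k b))
  where
  ◃k*1≡+k : ∀ k → _ ℤ.◃ (k ℕ.* 1) ≡ ℤ.+ k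
  ◃k*1≡+k k = trans (ℤₚ.+◃n≡+n (k ℕ.* 1)) (cong ℤ.+_ (ℕₚ.*-identityʳ k))

if-T : ∀ {A : Set} {b} {y z : A} → T b → (if b then y else z) ≡ y
if-T {b = true} _ = refl

T-not⇒¬T : ∀ {b} → T (not b) → ¬ T b
T-not⇒¬T {false} _ ()

T-extensional : ∀ {b c} → (T b → T c) → (T c → T b) → b ≡ c
T-extensional {false} {false} _ _ = refl
T-extensional {false} {true}  _ g = ⊥-elim (g _)
T-extensional {true}  {false} f _ = ⊥-elim (f _)
T-extensional {true}  {true}  _ _ = refl

≡ᵇ-comm : ∀ m n → (m ≡ᵇ n) ≡ (n ≡ᵇ m)
≡ᵇ-comm zero    zero    = refl
≡ᵇ-comm zero    (suc n) = refl
≡ᵇ-comm (suc m) zero    = refl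
≡ᵇ-comm (suc m) (suc n) = ≡ᵇ-comm m n

<ᵇ-asym : ∀ m n → T (n <ᵇ m) → (m <ᵇ n) ≡ false
<ᵇ-asym (suc m) zero    _   = refl
<ᵇ-asym (suc m) (suc n) n<m = <ᵇ-asym m n n<m

ΣFin≡sum : ∀ {m} (f : Fin m → ℚ) → ΣFin f ≡ sum f
ΣFin≡sum {zero}  f = refl
ΣFin≡sum {suc m} f = cong (f fzero +_) (ΣFin≡sum (f ∘ fsuc))

ΣFin-cong : ∀ {m} {f g : Fin m → ℚ} → (∀ k → f k ≡ g k) → ΣFin f ≡ ΣFin g
ΣFin-cong {f = f} {g} f≗g = trans (ΣFin≡sum f) (trans (sum-cong-≗ f≗g) (sym (ΣFin≡sum g)))

ΣFin-distrib-+ : ∀ {m} (f g : Fin m → ℚ) → ΣFin (λ k → f k + g k) ≡ ΣFin f + ΣFin g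
ΣFin-distrib-+ f g =
  trans (ΣFin≡sum (λ k → f k + g k)) (trans (∑-distrib-+ f g) (sym (cong₂ _+_ (ΣFin≡sum f) (ΣFin≡sum g))))

*-distribˡ-ΣFin : ∀ {m} c (f : Fin m → ℚ) → c * ΣFin f ≡ ΣFin (λ k → c * f k)
*-distribˡ-ΣFin c f = trans (cong (c *_) (ΣFin≡sum f)) (trans (*-distribˡ-sum c f) (sym (ΣFin≡sum (λ k → c * f k))))

ΣFin-zero : ∀ m → ΣFin {m} (λ _ → 0ℚ) ≡ 0ℚ
ΣFin-zero m = trans (ΣFin≡sum {m} (λ _ → 0ℚ)) (sum-replicate-zero m)

ΣFin-one : ∀ m → ΣFin {m} (λ _ → 1ℚ) ≡ ℕ→ℚ m
ΣFin-one zero    = refl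
ΣFin-one (suc m) = trans (cong (1ℚ +_) (ΣFin-one m)) (sym (ℕ→ℚ-+ 1 m))

ΣFin-comm : ∀ {m m′} (f : Fin m → Fin m′ → ℚ) → ΣFin (λ i → ΣFin (f i)) ≡ ΣFin (λ j → ΣFin (λ i → f i j))
ΣFin-comm f = trans (ΣFin²≡∑² f) (trans (∑-comm f) (sym (ΣFin²≡∑² (λ j i → f i j))))
  where
  ΣFin²≡∑² : ∀ {m m′} (f : Fin m → Fin m′ → ℚ) → ΣFin (λ i → ΣFin (f i)) ≡ sum (λ i → sum (f i))
  ΣFin²≡∑² f = trans (ΣFin≡sum (λ i → ΣFin (f i))) (sum-cong-≗ (λ i → ΣFin≡sum (f i)))

ΣFin-if-single : ∀ {m} (c : Fin m → Bool) (f : Fin m → ℚ) (u : Fin m) → (∀ k → T (c k) → k ≡ u) →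
                 ΣFin (λ k → if c k then f k else 0ℚ) ≡ (if c u then f u else 0ℚ)
ΣFin-if-single {suc m} c f u only-u = begin
  ΣFin h                     ≡⟨ ΣFin≡sum h ⟩
  sum h                      ≡⟨ sum-remove {i = u} h ⟩
  h u + sum (h ∘ punchIn u)  ≡⟨ cong (h u +_) (trans (sum-cong-≗ vanishes) (sum-replicate-zero m)) ⟩
  h u + 0ℚ                   ≡⟨ +-identityʳ (h u) ⟩
  h u                        ∎
  where
  open ≡-Reasoning
  h : Fin (suc m) → ℚ
  h k = if c k then f k else 0ℚ
  vanishes : ∀ k → h (punchIn u k) ≡ 0ℚ
  vanishes k with c (punchIn u k) in ck
  ... | true  = ⊥-elim (punchInᵢ≢i u k (only-u _ (from T-≡ ck)))
  ... | false = refl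

Σ² : ∀ {m m′} → (Fin m → Fin m′ → ℚ) → ℚ
Σ² F = ΣFin (λ i → ΣFin (F i))

Σ²-cong : ∀ {m m′} {F G : Fin m → Fin m′ → ℚ} → (∀ i j → F i j ≡ G i j) → Σ² F ≡ Σ² G
Σ²-cong F≗G = ΣFin-cong (λ i → ΣFin-cong (F≗G i))

Σ²-distrib-+ : ∀ {m m′} (F G : Fin m → Fin m′ → ℚ) → Σ² (λ i j → F i j + G i j) ≡ Σ² F + Σ² G
Σ²-distrib-+ F G =
  trans (ΣFin-cong (λ i → ΣFin-distrib-+ (F i) (G i))) (ΣFin-distrib-+ (λ i → ΣFin (F i)) (λ i → ΣFin (G i)))

*-distribˡ-Σ² : ∀ {m m′} c (F : Fin m → Fin m′ → ℚ) → c * Σ² F ≡ Σ² (λ i j → c * F i j)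
*-distribˡ-Σ² c F = trans (*-distribˡ-ΣFin c (λ i → ΣFin (F i))) (ΣFin-cong (λ i → *-distribˡ-ΣFin c (F i)))

Σ²-zero : ∀ m m′ → Σ² {m} {m′} (λ _ _ → 0ℚ) ≡ 0ℚ
Σ²-zero m m′ = trans (ΣFin-cong {m} (λ _ → ΣFin-zero m′)) (ΣFin-zero m)

if-Σ² : ∀ {m m′} b (F : Fin m → Fin m′ → ℚ) →
        (if b then Σ² F else 0ℚ) ≡ Σ² (λ i j → if b then F i j else 0ℚ)
if-Σ² true  F = refl
if-Σ² {m} {m′} false F = sym (Σ²-zero m m′)

Σ²-comm : ∀ {m m′ k k′} (F : Fin m → Fin m′ → Fin k → Fin k′ → ℚ) →
          Σ² (λ i j → Σ² (F i j)) ≡ Σ² (λ a b → Σ² (λ i j → F i j a b))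
Σ²-comm F = begin
  ΣFin (λ i → ΣFin (λ j → ΣFin (λ a → ΣFin (λ b → F i j a b))))
    ≡⟨ ΣFin-cong (λ i → ΣFin-comm (λ j a → ΣFin (F i j a))) ⟩
  ΣFin (λ i → ΣFin (λ a → ΣFin (λ j → ΣFin (λ b → F i j a b))))
    ≡⟨ ΣFin-comm (λ i a → ΣFin (λ j → ΣFin (F i j a))) ⟩
  ΣFin (λ a → ΣFin (λ i → ΣFin (λ j → ΣFin (λ b → F i j a b))))
    ≡⟨ ΣFin-cong (λ a → ΣFin-cong (λ i → ΣFin-comm (λ j b → F i j a b))) ⟩
  ΣFin (λ a → ΣFin (λ i → ΣFin (λ b → ΣFin (λ j → F i j a b))))
    ≡⟨ ΣFin-cong (λ a → ΣFin-comm (λ i b → ΣFin (λ j → F i j a b))) ⟩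
  ΣFin (λ a → ΣFin (λ b → ΣFin (λ i → ΣFin (λ j → F i j a b)))) ∎
  where open ≡-Reasoning

Σ²Σ²-antisym : ∀ {m m′} (F : Fin m → Fin m′ → Fin m → Fin m′ → ℚ) →
               (∀ i j a b → F i j a b + F a b i j ≡ 0ℚ) → Σ² (λ i j → Σ² (F i j)) ≡ 0ℚ
Σ²Σ²-antisym {m} {m′} F antisym = p+p≡0⇒p≡0 (begin
  S + S
    ≡⟨ cong (S +_) (Σ²-comm F) ⟩
  S + Σ² (λ i j → Σ² (F⊤ i j))
    ≡⟨ Σ²-distrib-+ (λ i j → Σ² (F i j)) (λ i j → Σ² (F⊤ i j)) ⟨
  Σ² (λ i j → Σ² (F i j) + Σ² (F⊤ i j))
    ≡⟨ Σ²-cong (λ i j → Σ²-distrib-+ (F i j) (F⊤ i j)) ⟨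
  Σ² (λ i j → Σ² (λ a b → F i j a b + F a b i j))
    ≡⟨ Σ²-cong (λ i j → trans (Σ²-cong (antisym i j)) (Σ²-zero m m′)) ⟩
  Σ² {m} {m′} (λ _ _ → 0ℚ)
    ≡⟨ Σ²-zero m m′ ⟩
  0ℚ ∎)
  where
  open ≡-Reasoning
  S = Σ² (λ i j → Σ² (F i j))
  F⊤ : Fin m → Fin m′ → Fin m → Fin m′ → ℚ
  F⊤ i j a b = F a b i j

lower : ∀ {m} → Fin m → Fin m → Bool
lower i j = toℕ j <ᵇ toℕ i

-- `edge i j a b` unfolds to `offDiag i j ∧ (offDiag a b ∧ adjacentᵇ (toℕ i) (toℕ j) (toℕ a) (toℕ b))`.
adjacentᵇ : ℕ → ℕ → ℕ → ℕ → Bool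
adjacentᵇ i j a b = ((∣ i - a ∣ ℕ.+ ∣ j - b ∣) ≡ᵇ 1) ∨ ((a ≡ᵇ j) ∧ (b ≡ᵇ i) ∧ (∣ i - j ∣ ≡ᵇ 1))

adjacentᵇ-transpose : ∀ i j a b → adjacentᵇ j i b a ≡ adjacentᵇ i j a b
adjacentᵇ-transpose i j a b
  rewrite +-comm ∣ j - b ∣ ∣ i - a ∣ | ∣-∣-comm j i | ∧-exchange (b ≡ᵇ i) (a ≡ᵇ j) (∣ i - j ∣ ≡ᵇ 1)
  = refl

adjacentᵇ-sym : ∀ i j a b → T (adjacentᵇ i j a b) → T (adjacentᵇ a b i j)
adjacentᵇ-sym i j a b adj with to T-∨ adj
... | inj₁ taxicab =
  from T-∨ (inj₁ (subst₂ (λ u v → T ((u ℕ.+ v) ≡ᵇ 1)) (∣-∣-comm i a) (∣-∣-comm j b) taxicab))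
... | inj₂ flip with to T-∧ flip
...   | a=j , flip′ with to T-∧ flip′
...     | b=i , ∣i-j∣≡1 with ≡ᵇ⇒≡ a j a=j | ≡ᵇ⇒≡ b i b=i
...       | refl | refl =
  from T-∨ (inj₂ (from T-∧ (≡⇒≡ᵇ i i refl ,
    from T-∧ (≡⇒≡ᵇ j j refl , subst (λ d → T (d ≡ᵇ 1)) (∣-∣-comm i j) ∣i-j∣≡1))))

∣m-n∣≡1⇒n≡1+m : ∀ {m n} → m < n → ∣ m - n ∣ ≡ 1 → n ≡ suc m
∣m-n∣≡1⇒n≡1+m {m} m<n ∣m-n∣≡1 =
  trans (sym (m∸n+n≡m (<⇒≤ m<n))) (cong (ℕ._+ m) (trans (sym (m≤n⇒∣m-n∣≡n∸m (<⇒≤ m<n))) ∣m-n∣≡1))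

∣m-o∣≢1 : ∀ {m n o} → m < n → n < o → ∣ m - o ∣ ≢ 1
∣m-o∣≢1 m<n n<o ∣m-o∣≡1 =
  <-irrefl refl (<-≤-trans m<n (m<1+n⇒m≤n (subst (_ <_) (∣m-n∣≡1⇒n≡1+m (<-trans m<n n<o) ∣m-o∣≡1) n<o)))

∣i-a∣+∣j-b∣≢1 : ∀ {i j a b} → j < i → a < b → ∣ i - a ∣ ℕ.+ ∣ j - b ∣ ≢ 1
∣i-a∣+∣j-b∣≢1 {i} {a = a} j<i a<b d with ∣ i - a ∣ in ∣i-a∣
... | 0 = ∣m-o∣≢1 j<i (subst (_< _) (sym (∣m-n∣≡0⇒m≡n ∣i-a∣)) a<b) d
... | 1 = ∣m-o∣≢1 a<b (subst (_< _) (∣m-n∣≡0⇒m≡n (suc-injective d)) j<i) (trans (∣-∣-comm a i) ∣i-a∣)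

adjacentᵇ-across : ∀ {i j a b} → j < i → a < b → T (adjacentᵇ i j a b) → a ≡ j × b ≡ i × i ≡ suc j
adjacentᵇ-across {i} {j} {a} {b} j<i a<b adj with to T-∨ adj
... | inj₁ taxicab = ⊥-elim (∣i-a∣+∣j-b∣≢1 j<i a<b (≡ᵇ⇒≡ _ 1 taxicab))
... | inj₂ flip with to T-∧ flip
...   | a=j , flip′ with to T-∧ flip′
...     | b=i , ∣i-j∣≡1 =
  ≡ᵇ⇒≡ a j a=j , ≡ᵇ⇒≡ b i b=i , ∣m-n∣≡1⇒n≡1+m j<i (trans (∣-∣-comm j i) (≡ᵇ⇒≡ _ 1 ∣i-j∣≡1))

edge⇒ : ∀ {n} (i j a b : Fin (suc n)) → T (edge i j a b) →
        T (offDiag i j) × T (offDiag a b) × T (adjacentᵇ (toℕ i) (toℕ j) (toℕ a) (toℕ b))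
edge⇒ i j a b ij~ab with to (T-∧ {offDiag i j}) ij~ab
... | i≢j , ab~ = i≢j , to (T-∧ {offDiag a b}) ab~

edge-transpose : ∀ {n} (i j a b : Fin (suc n)) → edge j i b a ≡ edge i j a b
edge-transpose i j a b
  rewrite ≡ᵇ-comm (toℕ j) (toℕ i) | ≡ᵇ-comm (toℕ b) (toℕ a)
        | adjacentᵇ-transpose (toℕ i) (toℕ j) (toℕ a) (toℕ b)
  = refl

edge-sym : ∀ {n} (i j a b : Fin (suc n)) → edge a b i j ≡ edge i j a b
edge-sym i j a b = T-extensional (edge-flip a b i j) (edge-flip i j a b)
  where
  edge-flip : ∀ {n} (i j a b : Fin (suc n)) → T (edge i j a b) → T (edge a b i j)
  edge-flip i j a b ij~ab with edge⇒ i j a b ij~ab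
  ... | i≢j , a≢b , adj =
    from (T-∧ {offDiag a b}) (a≢b ,
      from (T-∧ {offDiag i j}) (i≢j , adjacentᵇ-sym (toℕ i) (toℕ j) (toℕ a) (toℕ b) adj))

upper⇒< : ∀ {n} (a b : Fin (suc n)) → T (not (lower a b)) → T (offDiag a b) → toℕ a < toℕ b
upper⇒< a b b≮a a≢b = ≤∧≢⇒< (≮⇒≥ (T-not⇒¬T b≮a ∘ <⇒<ᵇ)) (T-not⇒¬T a≢b ∘ ≡⇒≡ᵇ _ _)

crossesDiagonal : ∀ {n} → (i j a b : Fin (suc n)) → Bool
crossesDiagonal i j a b = lower i j ∧ (not (lower a b) ∧ edge i j a b)

crossesDiagonal⇒ : ∀ {n} (i j a b : Fin (suc n)) → T (crossesDiagonal i j a b) →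
                   a ≡ j × b ≡ i × toℕ i ≡ suc (toℕ j)
crossesDiagonal⇒ i j a b cross with to (T-∧ {lower i j}) cross
... | j<i , cross′ with to (T-∧ {not (lower a b)}) cross′
... | b≮a , ij~ab with edge⇒ i j a b ij~ab
... | _ , a≢b , adj with adjacentᵇ-across (<ᵇ⇒< _ _ j<i) (upper⇒< a b b≮a a≢b) adj
... | a=j , b=i , i=1+j = toℕ-injective a=j , toℕ-injective b=i , i=1+j

crossesDiagonal-subdiagonal : ∀ {n} (k : Fin n) → T (crossesDiagonal (fsuc k) (inject₁ k) (inject₁ k) (fsuc k))
crossesDiagonal-subdiagonal fzero    = _
crossesDiagonal-subdiagonal (fsuc k) = crossesDiagonal-subdiagonal k

lower-subdiagonal : ∀ {n} (k : Fin n) → T (lower (fsuc k) (inject₁ k))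
lower-subdiagonal fzero    = _
lower-subdiagonal (fsuc k) = lower-subdiagonal k

offDiag-subdiagonal : ∀ {n} (k : Fin n) → T (offDiag (fsuc k) (inject₁ k))
offDiag-subdiagonal fzero    = _
offDiag-subdiagonal (fsuc k) = offDiag-subdiagonal k

ΣLower : ∀ {m} → (Fin m → Fin m → ℚ) → ℚ
ΣLower F = Σ² (λ i j → if lower i j then F i j else 0ℚ)

ΣLower-linear : ∀ {m} (F G : Fin m → Fin m → ℚ) c → ΣLower (λ i j → F i j + c * G i j) ≡ ΣLower F + c * ΣLower G
ΣLower-linear F G c = begin
  ΣLower (λ i j → F i j + c * G i j)          ≡⟨ Σ²-cong (λ i j → if-linear (lower i j) (F i j) (G i j)) ⟩
  Σ² (λ i j → F↓ i j + c * G↓ i j)            ≡⟨ Σ²-distrib-+ F↓ (λ i j → c * G↓ i j) ⟩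
  ΣLower F + Σ² (λ i j → c * G↓ i j)          ≡⟨ cong (ΣLower F +_) (*-distribˡ-Σ² c G↓) ⟨
  ΣLower F + c * ΣLower G                     ∎
  where
  open ≡-Reasoning
  F↓ G↓ : _ → _ → ℚ
  F↓ i j = if lower i j then F i j else 0ℚ
  G↓ i j = if lower i j then G i j else 0ℚ
  if-linear : ∀ b y z → (if b then y + c * z else 0ℚ) ≡ (if b then y else 0ℚ) + c * (if b then z else 0ℚ)
  if-linear true  _ _ = refl
  if-linear false _ _ = sym (trans (+-identityˡ _) (*-zeroʳ c))

Σ²Σ²-crossesDiagonal : ∀ {n} (G : (i j a b : Fin (suc n)) → ℚ) →
  Σ² (λ i j → Σ² (λ a b → if crossesDiagonal i j a b then G i j a b else 0ℚ)) ≡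
  ΣFin (λ k → G (fsuc k) (inject₁ k) (inject₁ k) (fsuc k))
Σ²Σ²-crossesDiagonal {n} G = begin
  Σ² (λ i j → Σ² (λ a b → if crossesDiagonal i j a b then G i j a b else 0ℚ))
    ≡⟨ Σ²-cong only-transpose ⟩
  Σ² H
    -- row 0 has nothing below the diagonal, so `H fzero j` computes to 0ℚ
    ≡⟨ cong₂ _+_ (ΣFin-zero (suc n)) (ΣFin-cong only-subdiagonal) ⟩
  0ℚ + ΣFin (λ k → G (fsuc k) (inject₁ k) (inject₁ k) (fsuc k))
    ≡⟨ +-identityˡ _ ⟩
  ΣFin (λ k → G (fsuc k) (inject₁ k) (inject₁ k) (fsuc k)) ∎
  where
  open ≡-Reasoning
  H : Fin (suc n) → Fin (suc n) → ℚ
  H i j = if crossesDiagonal i j j i then G i j j i else 0ℚ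

  only-transpose : ∀ i j → Σ² (λ a b → if crossesDiagonal i j a b then G i j a b else 0ℚ) ≡ H i j
  only-transpose i j = trans
    (ΣFin-cong (λ a → ΣFin-if-single (crossesDiagonal i j a) (G i j a) i
                                     (λ b → proj₁ ∘ proj₂ ∘ crossesDiagonal⇒ i j a b)))
    (ΣFin-if-single (λ a → crossesDiagonal i j a i) (λ a → G i j a i) j (λ a → proj₁ ∘ crossesDiagonal⇒ i j a i))

  crossing-column : ∀ k j → T (crossesDiagonal (fsuc k) j j (fsuc k)) → j ≡ inject₁ k
  crossing-column k j cross = toℕ-injective (begin
    toℕ j            ≡⟨ suc-injective (proj₂ (proj₂ (crossesDiagonal⇒ (fsuc k) j j (fsuc k) cross))) ⟨
    toℕ k            ≡⟨ toℕ-inject₁ k ⟨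
    toℕ (inject₁ k)  ∎)

  only-subdiagonal : ∀ k → ΣFin (H (fsuc k)) ≡ G (fsuc k) (inject₁ k) (inject₁ k) (fsuc k)
  only-subdiagonal k = trans
    (ΣFin-if-single (λ j → crossesDiagonal (fsuc k) j j (fsuc k)) (λ j → G (fsuc k) j j (fsuc k)) (inject₁ k)
                    (crossing-column k))
    (if-T (crossesDiagonal-subdiagonal k))

ΣLower-nbrSum : ∀ {n} (f : Fin (suc n) → Fin (suc n) → ℚ) →
                ΣLower (nbrSum f) ≡ ΣFin (λ k → f (inject₁ k) (fsuc k) - f (fsuc k) (inject₁ k))
ΣLower-nbrSum {n} f = begin
  ΣLower (nbrSum f)
    ≡⟨ Σ²-cong (λ i j → trans (if-Σ² (lower i j) (flux i j))
                              (Σ²-cong (λ a b → if-split (lower i j) (lower a b) (edge i j a b) (g i j a b)))) ⟩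
  Σ² (λ i j → Σ² (λ a b → within i j a b + across i j a b))
    ≡⟨ Σ²-cong (λ i j → Σ²-distrib-+ (within i j) (across i j)) ⟩
  Σ² (λ i j → Σ² (within i j) + Σ² (across i j))
    ≡⟨ Σ²-distrib-+ (λ i j → Σ² (within i j)) (λ i j → Σ² (across i j)) ⟩
  Σ² (λ i j → Σ² (within i j)) + Σ² (λ i j → Σ² (across i j))
    ≡⟨ cong₂ _+_ (Σ²Σ²-antisym within within-antisym) (Σ²Σ²-crossesDiagonal g) ⟩
  0ℚ + ΣFin (λ k → f (inject₁ k) (fsuc k) - f (fsuc k) (inject₁ k))
    ≡⟨ +-identityˡ _ ⟩
  ΣFin (λ k → f (inject₁ k) (fsuc k) - f (fsuc k) (inject₁ k)) ∎
  where
  open ≡-Reasoning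
  g flux within across : (i j a b : Fin (suc n)) → ℚ
  g i j a b = f a b - f i j
  flux i j a b = if edge i j a b then g i j a b else 0ℚ
  within i j a b = if lower i j ∧ (lower a b ∧ edge i j a b) then g i j a b else 0ℚ
  across i j a b = if crossesDiagonal i j a b then g i j a b else 0ℚ

  if-split : ∀ b c d y → (if b then (if d then y else 0ℚ) else 0ℚ) ≡
                         (if b ∧ (c ∧ d) then y else 0ℚ) + (if b ∧ (not c ∧ d) then y else 0ℚ)
  if-split false _     _ _ = sym (+-identityʳ 0ℚ)
  if-split true  true  _ _ = sym (+-identityʳ _)
  if-split true  false _ _ = sym (+-identityˡ _)

  within-antisym : ∀ i j a b → within i j a b + within a b i j ≡ 0ℚ
  within-antisym i j a b
    rewrite edge-sym i j a b | ∧-exchange (lower a b) (lower i j) (edge i j a b)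
    with lower i j ∧ (lower a b ∧ edge i j a b)
  ... | true  = opposite (f a b) (f i j)
    where
    opposite : ∀ u v → (u - v) + (v - u) ≡ 0ℚ
    opposite = solve-∀ ℚ-ring
  ... | false = +-identityʳ 0ℚ

Complementary : ∀ {n} → (Fin (suc n) → Fin (suc n) → ℚ) → Set
Complementary f = ∀ i j → T (offDiag i j) → f i j + f j i ≡ 1ℚ

differences-cancel : ∀ u v w z → u + w ≡ 1ℚ → v + z ≡ 1ℚ → (u - v) + (w - z) ≡ 0ℚ
differences-cancel u v w z u+w≡1 v+z≡1 = begin
  (u - v) + (w - z)  ≡⟨ regroup u v w z ⟩
  (u + w) - (v + z)  ≡⟨ cong₂ _-_ u+w≡1 v+z≡1 ⟩
  1ℚ - 1ℚ            ≡⟨ +-inverseʳ 1ℚ ⟩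
  0ℚ                 ∎
  where
  open ≡-Reasoning
  regroup : ∀ u v w z → (u - v) + (w - z) ≡ (u + w) - (v + z)
  regroup = solve-∀ ℚ-ring

nbrSum-antisym : ∀ {n} (f : Fin (suc n) → Fin (suc n) → ℚ) → Complementary f →
                 ∀ i j → nbrSum f i j + nbrSum f j i ≡ 0ℚ
nbrSum-antisym {n} f complementary i j = begin
  nbrSum f i j + nbrSum f j i                  ≡⟨ cong (nbrSum f i j +_) (ΣFin-comm (flux j i)) ⟩
  Σ² (flux i j) + Σ² (λ a b → flux j i b a)    ≡⟨ Σ²-distrib-+ (flux i j) (λ a b → flux j i b a) ⟨
  Σ² (λ a b → flux i j a b + flux j i b a)     ≡⟨ Σ²-cong cancel ⟩
  Σ² {suc n} {suc n} (λ _ _ → 0ℚ)              ≡⟨ Σ²-zero (suc n) (suc n) ⟩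
  0ℚ                                           ∎
  where
  open ≡-Reasoning
  flux : (i j a b : Fin (suc n)) → ℚ
  flux i j a b = if edge i j a b then f a b - f i j else 0ℚ
  cancel : ∀ a b → flux i j a b + flux j i b a ≡ 0ℚ
  cancel a b rewrite edge-transpose i j a b with edge i j a b in ij~ab
  ... | true  = let i≢j , a≢b , _ = edge⇒ i j a b (from T-≡ ij~ab)
                in differences-cancel (f a b) (f i j) (f b a) (f j i) (complementary a b a≢b) (complementary i j i≢j)
  ... | false = +-identityʳ 0ℚ

initial-complementary : ∀ m n → T (not (m ≡ᵇ n)) →
                        (if m <ᵇ n then 1ℚ else 0ℚ) + (if n <ᵇ m then 1ℚ else 0ℚ) ≡ 1ℚ
initial-complementary zero    (suc n) _   = +-identityʳ 1ℚ
initial-complementary (suc m) zero    _   = +-identityˡ 1ℚ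
initial-complementary (suc m) (suc n) m≢n = initial-complementary m n m≢n

p-complementary : ∀ n x t → Complementary (p n x t)
p-complementary n x zero    i j i≢j = initial-complementary (toℕ i) (toℕ j) i≢j
p-complementary n x (suc t) i j i≢j = begin
  (P i j + x * N i j) + (P j i + x * N j i)  ≡⟨ regroup (P i j) (P j i) (N i j) (N j i) x ⟩
  (P i j + P j i) + x * (N i j + N j i)      ≡⟨ cong₂ (λ u v → u + x * v) (p-complementary n x t i j i≢j)
                                                  (nbrSum-antisym P (p-complementary n x t) i j) ⟩
  1ℚ + x * 0ℚ                                ≡⟨ cong (1ℚ +_) (*-zeroʳ x) ⟩
  1ℚ + 0ℚ                                    ≡⟨ +-identityʳ 1ℚ ⟩
  1ℚ                                         ∎
  where
  open ≡-Reasoning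
  P N : Fin (suc n) → Fin (suc n) → ℚ
  P = p n x t
  N = nbrSum P
  regroup : ∀ a b c d x → (a + x * c) + (b + x * d) ≡ (a + b) + x * (c + d)
  regroup = solve-∀ ℚ-ring

ΣLower-nbrSum-complementary : ∀ {n} (f : Fin (suc n) → Fin (suc n) → ℚ) → Complementary f →
  ΣLower (nbrSum f) ≡ ℕ→ℚ n - ℕ→ℚ 2 * ΣFin (λ k → f (fsuc k) (inject₁ k))
ΣLower-nbrSum-complementary {n} f complementary = begin
  ΣLower (nbrSum f)
    ≡⟨ ΣLower-nbrSum f ⟩
  ΣFin (λ k → f (inject₁ k) (fsuc k) - s k)
    ≡⟨ ΣFin-cong (λ k → flip-flux (s k) _ (complementary (fsuc k) (inject₁ k) (offDiag-subdiagonal k))) ⟩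
  ΣFin (λ k → 1ℚ + (- ℕ→ℚ 2) * s k)
    ≡⟨ ΣFin-distrib-+ (λ _ → 1ℚ) (λ k → (- ℕ→ℚ 2) * s k) ⟩
  ΣFin {n} (λ _ → 1ℚ) + ΣFin (λ k → (- ℕ→ℚ 2) * s k)
    ≡⟨ cong₂ _+_ (ΣFin-one n) (sym (*-distribˡ-ΣFin (- ℕ→ℚ 2) s)) ⟩
  ℕ→ℚ n + (- ℕ→ℚ 2) * ΣFin s
    ≡⟨ cong (ℕ→ℚ n +_) (neg-distribˡ-* (ℕ→ℚ 2) (ΣFin s)) ⟨
  ℕ→ℚ n - ℕ→ℚ 2 * ΣFin s ∎
  where
  open ≡-Reasoning
  s : Fin n → ℚ
  s k = f (fsuc k) (inject₁ k)
  flip-flux : ∀ y z → y + z ≡ 1ℚ → z - y ≡ 1ℚ + (- ℕ→ℚ 2) * y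
  flip-flux y z y+z≡1 = trans (rearrange y z) (cong (_+ (- ℕ→ℚ 2) * y) y+z≡1)
    where
    rearrange : ∀ y z → z - y ≡ (y + z) + (- (1ℚ + 1ℚ)) * y
    rearrange = solve-∀ ℚ-ring

p-initial-lower : ∀ n x (i j : Fin (suc n)) → T (lower i j) → p n x 0 i j ≡ 0ℚ
p-initial-lower n x i j j<i = cong (λ b → if b then 1ℚ else 0ℚ) (<ᵇ-asym (toℕ i) (toℕ j) j<i)

E-initial : ∀ n x → E n x 0 ≡ 0ℚ
E-initial n x = trans (Σ²-cong vanish) (Σ²-zero (suc n) (suc n))
  where
  vanish : ∀ i j → (if lower i j then p n x 0 i j else 0ℚ) ≡ 0ℚ
  vanish i j with lower i j in j<i
  ... | true  = p-initial-lower n x i j (from T-≡ j<i)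
  ... | false = refl

e-initial : ∀ n x → e n x 0 ≡ 0ℚ
e-initial n x = trans (ΣFin-cong (λ k → p-initial-lower n x (fsuc k) (inject₁ k) (lower-subdiagonal k))) (ΣFin-zero n)

E-suc : ∀ n x t → E n x (suc t) ≡ E n x t + x * (ℕ→ℚ n - ℕ→ℚ 2 * e n x t)
E-suc n x t = trans (ΣLower-linear (p n x t) (nbrSum (p n x t)) x)
                    (cong (λ d → E n x t + x * d) (ΣLower-nbrSum-complementary (p n x t) (p-complementary n x t)))

eTail-pred-+ : ∀ n x t → eTail n x (t ∸ 1) + e n x t ≡ eTail n x t
eTail-pred-+ n x zero    = trans (+-identityˡ _) (e-initial n x)
eTail-pred-+ n x (suc t) = refl

E-closed-form : ∀ n x t → E n x t ≡ ℕ→ℚ (n *ℕ t) * x - (ℕ→ℚ 2 * x) * eTail n x (t ∸ 1)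
E-closed-form n x zero rewrite ℕₚ.*-zeroʳ n = trans (E-initial n x) (vanish x (ℕ→ℚ 2))
  where
  vanish : ∀ x c → 0ℚ ≡ 0ℚ * x - (c * x) * 0ℚ
  vanish = solve-∀ ℚ-ring
E-closed-form n x (suc t) = begin
  E n x (suc t)
    ≡⟨ E-suc n x t ⟩
  E n x t + x * (ℕ→ℚ n - ℕ→ℚ 2 * e n x t)
    ≡⟨ cong (_+ x * (ℕ→ℚ n - ℕ→ℚ 2 * e n x t)) (E-closed-form n x t) ⟩
  (ℕ→ℚ (n *ℕ t) * x - (ℕ→ℚ 2 * x) * eTail n x (t ∸ 1)) + x * (ℕ→ℚ n - ℕ→ℚ 2 * e n x t)
    ≡⟨ collect (ℕ→ℚ (n *ℕ t)) (ℕ→ℚ n) x (ℕ→ℚ 2) (eTail n x (t ∸ 1)) (e n x t) ⟩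
  (ℕ→ℚ n + ℕ→ℚ (n *ℕ t)) * x - (ℕ→ℚ 2 * x) * (eTail n x (t ∸ 1) + e n x t)
    ≡⟨ cong₂ (λ a s → a * x - (ℕ→ℚ 2 * x) * s) ℕ→ℚ-*-suc (eTail-pred-+ n x t) ⟩
  ℕ→ℚ (n *ℕ suc t) * x - (ℕ→ℚ 2 * x) * eTail n x t ∎
  where
  open ≡-Reasoning
  collect : ∀ A N x c S y → (A * x - (c * x) * S) + x * (N - c * y) ≡ (N + A) * x - (c * x) * (S + y)
  collect = solve-∀ ℚ-ring
  ℕ→ℚ-*-suc : ℕ→ℚ n + ℕ→ℚ (n *ℕ t) ≡ ℕ→ℚ (n *ℕ suc t)
  ℕ→ℚ-*-suc = sym (trans (cong ℕ→ℚ (ℕₚ.*-suc n t)) (ℕ→ℚ-+ n (n *ℕ t)))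

lemma2 : (n : ℕ) → n ≥ 1 → (x : ℚ) → (t : ℕ) → t ≥ 1 →
    E n x t ≡ (ℕ→ℚ (n *ℕ t) * x) - (ℕ→ℚ 2 * x) * eTail n x (t ∸ 1)
lemma2 n _ x t _ = E-closed-form n x t
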